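{- Let $a=(a_k)_{k\ge1}$ be a sequence of complex numbers with $a_1=0$, and let $(\tau a)_k=a_{k+1}$, so that $(u\mid\tau a)^r=\prod_{j=2}^{r+1}(u-a_j)$. Then $$\sum_{r=0}^\infty\frac{Q_{(r);a}(x_1,x_2,\dots)}{(u\mid\tau a)^r}=\prod_{j=1}^\infty\frac{u+x_j}{u-x_j},$$ as an identity of formal power series in $u^{ -1}$ with coefficients in $\Gamma$ (equivalently, for every $n$, after setting $x_j=0$ for $j>n$ both sides agree as expansions in powers of $u^{ -1}$).
   Context: $\Gamma$ is the algebra of supersymmetric functions: sequences $(f_m)_{m\ge1}$ of supersymmetric polynomials (symmetric, and independent of $t$ after substituting $x_i=t,x_j=-t$) with $f_{m+1}(x_1,\dots,x_m,0)=f_m$ and bounded degrees. Put $(x\mid a)^k=\prod_{m=1}^k(x-a_m)$, $(x\mid a)^0=1$. For $r\ge1$ and $m\ge1$, $P_{(r);a}(x_1,\dots,x_m)=\frac1{(m-1)!}\sum_{\omega\in S(m)}(x_{\omega(1)}\mid a)^r\prod_{1<j\le m}\frac{x_{\omega(1)}+x_{\omega(j)}}{x_{\omega(1)}-x_{\omega(j)}}$, defining $P_{(r);a}\in\Gamma$; $Q_{(r);a}=2P_{(r);a}$ for $r\ge1$ and $Q_{(0);a}=1$. Each $1/(u\mid\tau a)^r$ is expanded in powers of $u^{ -1}$. -}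

module Defs where

open import Level using (Level; _⊔_) renaming (suc to lsuc)
open import Data.Nat using (ℕ; zero; suc; _∸_)
open import Data.Fin using (Fin; zero; suc; toℕ)
open import Relation.Nullary using (¬_; yes; no)
open import Relation.Binary.PropositionalEquality using (_≡_)
open import Algebra.Bundles using (CommutativeRing)
import Data.Fin as Fin

-- A field: a commutative ring with a (total) inverse map which is a genuine
-- inverse on nonzero elements, 1 ≠ 0, and characteristic zero (like ℂ).
-- (0⁻¹ is an arbitrary value; it is never used under the hypotheses.)
-- the image of a natural number in a ring
ιR : {c ℓ : Level} (R : CommutativeRing c ℓ) → ℕ → CommutativeRing.Carrier R
ιR R zero    = CommutativeRing.0# R
ιR R (suc n) = CommutativeRing._+_ R (CommutativeRing.1# R) (ιR R n)

record Field (c ℓ : Level) : Set (lsuc (c ⊔ ℓ)) where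
  field
    commutativeRing : CommutativeRing c ℓ
  open CommutativeRing commutativeRing public
  field
    _⁻¹       : Carrier → Carrier
    ⁻¹-inverse : ∀ x → ¬ (x ≈ 0#) → (x * (x ⁻¹)) ≈ 1#
    char-0    : ∀ n → ¬ (ιR commutativeRing (suc n) ≈ 0#)

module FieldDefs {c ℓ : Level} (F : Field c ℓ) where
  open Field F using (Carrier; _+_; _*_; -_; _-_; 0#; 1#; _⁻¹)

  _/_ : Carrier → Carrier → Carrier
  x / y = x * (y ⁻¹)

  sumF : (n : ℕ) → (Fin n → Carrier) → Carrier
  sumF zero    f = 0#
  sumF (suc n) f = f zero + sumF n (λ i → f (suc i))

  prodF : (n : ℕ) → (Fin n → Carrier) → Carrier
  prodF zero    f = 1#
  prodF (suc n) f = f zero * prodF n (λ i → f (suc i))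

  -- (x | a)^k = ∏_{m=1}^k (x - a_m); the sequence a is given as a : ℕ → Carrier
  -- with a k = a_k for k ≥ 1 (the value a 0 is never used).
  fpow : Carrier → (ℕ → Carrier) → ℕ → Carrier
  fpow x a zero    = 1#
  fpow x a (suc k) = fpow x a k * (x - a (suc k))

  τ : (ℕ → Carrier) → (ℕ → Carrier)
  τ a k = a (suc k)

  prodNe : (n : ℕ) → Fin n → (Fin n → Carrier) → Carrier
  prodNe n i f = prodF n (λ j → g j (i Fin.≟ j))
    where
    open import Relation.Nullary using (Dec)
    g : (j : Fin n) → Dec (i ≡ j) → Carrier
    g j (yes _) = 1#
    g j (no _)  = f j

  -- P_{(r);a}(x_1,…,x_n) for r ≥ 1, written with the sum over S(n) grouped by
  -- ω(1) = i (the summand depends only on ω(1); each class has (n-1)! elements):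
  --   Σ_i (x_i | a)^r ∏_{j ≠ i} (x_i + x_j)/(x_i - x_j)
  P : (ℕ → Carrier) → ℕ → (n : ℕ) → (Fin n → Carrier) → Carrier
  P a r n x = sumF n (λ i → fpow (x i) a r *
                 prodNe n i (λ j → (x i + x j) / (x i - x j)))

  Q : (ℕ → Carrier) → ℕ → (n : ℕ) → (Fin n → Carrier) → Carrier
  Q a zero    n x = 1#
  Q a (suc r) n x = (1# + 1#) * P a (suc r) n x

  -- Formal power series in t = u⁻¹ with coefficients in the field
  Series : Set c
  Series = ℕ → Carrier

  oneS : Series
  oneS zero    = 1#
  oneS (suc _) = 0#

  _⊛_ : Series → Series → Series
  (f ⊛ g) N = sumF (suc N) (λ i → f (toℕ i) * g (N ∸ toℕ i))

  prodS : (n : ℕ) → (Fin n → Series) → Series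
  prodS zero    f = oneS
  prodS (suc n) f = f zero ⊛ prodS n (λ i → f (suc i))

  -- expansion of 1/(u - b) = t/(1 - b t) = Σ_{k≥0} b^k t^{k+1}
  invLin : Carrier → Series
  invLin b zero    = 0#
  invLin b (suc k) = b ^′ k
    where
    _^′_ : Carrier → ℕ → Carrier
    y ^′ zero  = 1#
    y ^′ suc m = y * (y ^′ m)

  -- expansion of u + b = u (1 + b t); we expand (u + b)/(u - b) as
  -- (1 + b t) · (1/(1 - b t)) = (1 + b t) · u·(1/(u - b))
  linT : Carrier → Series
  linT b zero          = 1#
  linT b (suc zero)    = b
  linT b (suc (suc _)) = 0#

  ratio : Carrier → Series
  ratio b N = (linT b ⊛ invLin b) (suc N)   -- multiply by u = shift down

  -- expansion of 1/(u | c)^r = ∏_{m=1}^r 1/(u - c_m)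
  invFpow : (ℕ → Carrier) → ℕ → Series
  invFpow c r = prodS r (λ m → invLin (c (suc (toℕ m))))

  -- coefficient of u^{-N} in Σ_{r≥0} Q_{(r);a}(x) / (u | τ a)^r.
  -- Since 1/(u|τa)^r ∈ u^{-r} F[[u^{-1}]], only r ≤ N contribute.
  lhsCoeff : (ℕ → Carrier) → (n : ℕ) → (Fin n → Carrier) → ℕ → Carrier
  lhsCoeff a n x N =
    sumF (suc N) (λ r → Q a (toℕ r) n x * invFpow (τ a) (toℕ r) N)

  rhsCoeff : (n : ℕ) → (Fin n → Carrier) → ℕ → Carrier
  rhsCoeff n x N = prodS n (λ j → ratio (x j)) N

module Submission where

-- Since a₁ = 0, (x | a)^(r+1) = x (x | τa)^r, so Newton's expansion
-- 1/(u - x) = Σ_r (x | b)^r / (u | b)^(r+1) at the nodes b = τa collapses the left-hand side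
-- to 1 + Σ_i c_i 2x_i/(u - x_i) with c_i = ∏_{j≠i} (x_i + x_j)/(x_i - x_j).  The product
-- ∏_j (u + x_j)/(u - x_j) has the same partial-fraction decomposition, by induction on n
-- from the two-pole identity
--   (u + v)/(u - v) · 2y/(u - y) = 2y/(v - y) · 2v/(u - v) + (y + v)/(y - v) · 2y/(u - y).
-- The induction step needs the coefficient c_0, which is the product over the remaining
-- points evaluated at u = x_0; so the decomposition is proved once for any space of
-- "rational functions in u" and used both for evaluation at a point and for expansion in u⁻¹.

open import Defs
open import Level using (Level; _⊔_) renaming (suc to lsuc)
open import Data.Nat as ℕ using (ℕ; zero; suc; _∸_; _≤_; _<_; z≤n)
import Data.Nat.Properties as ℕ
open import Data.Fin using (Fin; zero; suc; toℕ; _≟_)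
open import Data.Fin.Properties using (suc-injective)
open import Data.Integer as ℤ using (ℤ; -[1+_])
import Data.Integer.Properties as ℤ
import Data.Sign as Sign
open import Data.Maybe using (Maybe; just; nothing)
open import Data.Product using (Σ-syntax; _,_; proj₁; proj₂)
open import Data.Unit.Polymorphic using (⊤; tt)
open import Function using (_∘_)
open import Relation.Nullary using (¬_; Dec; yes; no)
open import Relation.Binary.PropositionalEquality using (_≡_; _≢_)
import Relation.Binary.PropositionalEquality as ≡
open import Algebra.Bundles using (CommutativeRing)
open import Algebra.Solver.Ring.AlmostCommutativeRing
  using (AlmostCommutativeRing; fromCommutativeRing; _-Raw-AlmostCommutative⟶_)

module IntegerCoefficients {c ℓ : Level} (R : CommutativeRing c ℓ) where
  open CommutativeRing R
  open import Algebra.Properties.Monoid.Mult.TCOptimised +-monoid using (_×_; ×-homo-+; 1+×)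
  open import Algebra.Properties.Semiring.Mult.TCOptimised semiring using (×1-homo-*)
  open import Algebra.Properties.Ring ring using (-‿distribˡ-*; -‿distribʳ-*)
  open import Algebra.Properties.AbelianGroup +-abelianGroup using (⁻¹-∙-comm)
  open import Algebra.Properties.Group +-group using (⁻¹-involutive; ε⁻¹≈ε)
  open import Relation.Binary.Reasoning.Setoid setoid

  -- With the optimised _×_, ⟦ ℤ.+ 2 ⟧ℤ reduces to 1# + 1#, so that the solver's constants
  -- match the 1# + 1# occurring in Defs.
  ⟦_⟧ℤ : ℤ → Carrier
  ⟦ ℤ.+ n ⟧ℤ    = n × 1#
  ⟦ -[1+ n ] ⟧ℤ = - (suc n × 1#)

  private
    1+a-[1+b]≈a-b : ∀ a b → (1# + a) - (1# + b) ≈ a - b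
    1+a-[1+b]≈a-b a b = begin
      (1# + a) + - (1# + b)    ≈⟨ +-congˡ (⁻¹-∙-comm 1# b) ⟨
      (1# + a) + (- 1# + - b)  ≈⟨ +-congʳ (+-comm 1# a) ⟩
      (a + 1#) + (- 1# + - b)  ≈⟨ +-assoc a 1# _ ⟩
      a + (1# + (- 1# + - b))  ≈⟨ +-congˡ (+-assoc 1# (- 1#) (- b)) ⟨
      a + ((1# - 1#) + - b)    ≈⟨ +-congˡ (+-congʳ (-‿inverseʳ 1#)) ⟩
      a + (0# + - b)           ≈⟨ +-congˡ (+-identityˡ (- b)) ⟩
      a - b                    ∎

    ⊖-homo : ∀ m n → ⟦ m ℤ.⊖ n ⟧ℤ ≈ m × 1# - n × 1#
    ⊖-homo zero    zero    = sym (-‿inverseʳ 0#)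
    ⊖-homo (suc m) zero    = sym (trans (+-congˡ ε⁻¹≈ε) (+-identityʳ _))
    ⊖-homo zero    (suc n) = sym (+-identityˡ _)
    ⊖-homo (suc m) (suc n) = begin
      ⟦ suc m ℤ.⊖ suc n ⟧ℤ               ≡⟨ ≡.cong ⟦_⟧ℤ (ℤ.[1+m]⊖[1+n]≡m⊖n m n) ⟩
      ⟦ m ℤ.⊖ n ⟧ℤ                       ≈⟨ ⊖-homo m n ⟩
      m × 1# - n × 1#                    ≈⟨ 1+a-[1+b]≈a-b _ _ ⟨
      (1# + m × 1#) - (1# + n × 1#)      ≈⟨ +-cong (1+× m 1#) (-‿cong (1+× n 1#)) ⟨
      suc m × 1# - suc n × 1#            ∎

    +-homo : ∀ i j → ⟦ i ℤ.+ j ⟧ℤ ≈ ⟦ i ⟧ℤ + ⟦ j ⟧ℤ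
    +-homo (ℤ.+ m)  (ℤ.+ n)  = ×-homo-+ 1# m n
    +-homo (ℤ.+ m)  -[1+ n ] = ⊖-homo m (suc n)
    +-homo -[1+ m ] (ℤ.+ n)  = trans (⊖-homo n (suc m)) (+-comm _ _)
    +-homo -[1+ m ] -[1+ n ] = begin
      - (suc (suc (m ℕ.+ n)) × 1#)       ≡⟨ ≡.cong (λ k → - (suc k × 1#)) (ℕ.+-suc m n) ⟨
      - ((suc m ℕ.+ suc n) × 1#)         ≈⟨ -‿cong (×-homo-+ 1# (suc m) (suc n)) ⟩
      - (suc m × 1# + suc n × 1#)        ≈⟨ ⁻¹-∙-comm _ _ ⟨
      - (suc m × 1#) + - (suc n × 1#)    ∎

    +◃n-homo : ∀ n → ⟦ Sign.+ ℤ.◃ n ⟧ℤ ≈ n × 1#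
    +◃n-homo zero    = refl
    +◃n-homo (suc n) = refl

    -◃n-homo : ∀ n → ⟦ Sign.- ℤ.◃ n ⟧ℤ ≈ - (n × 1#)
    -◃n-homo zero    = sym ε⁻¹≈ε
    -◃n-homo (suc n) = refl

    -x*-y≈x*y : ∀ x y → - x * - y ≈ x * y
    -x*-y≈x*y x y = trans (sym (-‿distribˡ-* x (- y)))
                          (trans (-‿cong (sym (-‿distribʳ-* x y))) (⁻¹-involutive (x * y)))

    *-homo : ∀ i j → ⟦ i ℤ.* j ⟧ℤ ≈ ⟦ i ⟧ℤ * ⟦ j ⟧ℤ
    *-homo (ℤ.+ m)  (ℤ.+ n)  = trans (+◃n-homo (m ℕ.* n)) (×1-homo-* m n)
    *-homo (ℤ.+ m)  -[1+ n ] = trans (-◃n-homo (m ℕ.* suc n))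
                                 (trans (-‿cong (×1-homo-* m (suc n))) (-‿distribʳ-* _ _))
    *-homo -[1+ m ] (ℤ.+ n)  = trans (-◃n-homo (suc m ℕ.* n))
                                 (trans (-‿cong (×1-homo-* (suc m) n)) (-‿distribˡ-* _ _))
    *-homo -[1+ m ] -[1+ n ] = trans (+◃n-homo (suc m ℕ.* suc n))
                                 (trans (×1-homo-* (suc m) (suc n)) (sym (-x*-y≈x*y _ _)))

    -‿homo : ∀ i → ⟦ ℤ.- i ⟧ℤ ≈ - ⟦ i ⟧ℤ
    -‿homo (ℤ.+ zero)  = sym ε⁻¹≈ε
    -‿homo (ℤ.+ suc n) = refl
    -‿homo -[1+ n ]    = sym (⁻¹-involutive _)

    almostRing : AlmostCommutativeRing c ℓ
    almostRing = fromCommutativeRing R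

    ℤ⟶R : ℤ.+-*-rawRing -Raw-AlmostCommutative⟶ almostRing
    ℤ⟶R = record
      { ⟦_⟧ = ⟦_⟧ℤ ; +-homo = +-homo ; *-homo = *-homo ; -‿homo = -‿homo
      ; 0-homo = refl ; 1-homo = refl }

    _≟ℤ_ : ∀ i j → Maybe (⟦ i ⟧ℤ ≈ ⟦ j ⟧ℤ)
    i ≟ℤ j with i ℤ.≟ j
    ... | yes ≡.refl = just refl
    ... | no _       = nothing

  open import Algebra.Solver.Ring ℤ.+-*-rawRing almostRing ℤ⟶R _≟ℤ_ public
    using (solve; _:=_; _:+_; _:*_; _:-_; :-_; con; Polynomial)

  lit : ∀ {m} → ℕ → Polynomial m
  lit k = con (ℤ.+ k)

module Lemmas {c ℓ : Level} (F : Field c ℓ) where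
  open Field F hiding (ring; zero)
  open FieldDefs F
  open IntegerCoefficients commutativeRing
  open import Algebra.Properties.Semiring.Sum semiring
    using ( sum; sum-cong-≋; sum-cong-≗; sum-replicate-zero; ∑-distrib-+; ∑-comm
          ; *-distribˡ-sum; *-distribʳ-sum)
  open import Algebra.Properties.CommutativeSemigroup *-commutativeSemigroup using (x∙yz≈y∙xz)
  open import Relation.Binary.Reasoning.Setoid setoid

  two : Carrier
  two = 1# + 1#

  sumF≡sum : ∀ n (f : Fin n → Carrier) → sumF n f ≡ sum f
  sumF≡sum zero    f = ≡.refl
  sumF≡sum (suc n) f = ≡.cong (f zero +_) (sumF≡sum n (f ∘ suc))

  sumF-cong : ∀ n {f g : Fin n → Carrier} → (∀ i → f i ≈ g i) → sumF n f ≈ sumF n g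
  sumF-cong n {f} {g} f≈g rewrite sumF≡sum n f | sumF≡sum n g = sum-cong-≋ f≈g

  sumF-+ : ∀ n (f g : Fin n → Carrier) → sumF n (λ i → f i + g i) ≈ sumF n f + sumF n g
  sumF-+ n f g
    rewrite sumF≡sum n (λ i → f i + g i) | sumF≡sum n f | sumF≡sum n g = ∑-distrib-+ f g

  *-distribˡ-sumF : ∀ n x (f : Fin n → Carrier) → x * sumF n f ≈ sumF n (λ i → x * f i)
  *-distribˡ-sumF n x f
    rewrite sumF≡sum n f | sumF≡sum n (λ i → x * f i) = *-distribˡ-sum x f

  *-distribʳ-sumF : ∀ n x (f : Fin n → Carrier) → sumF n f * x ≈ sumF n (λ i → f i * x)
  *-distribʳ-sumF n x f
    rewrite sumF≡sum n f | sumF≡sum n (λ i → f i * x) = *-distribʳ-sum x f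

  sumF-comm : ∀ m n (f : Fin m → Fin n → Carrier) →
              sumF m (λ i → sumF n (f i)) ≈ sumF n (λ j → sumF m (λ i → f i j))
  sumF-comm m n f = trans (reflexive (sumF²≡sum² m n f))
    (trans (∑-comm f) (reflexive (≡.sym (sumF²≡sum² n m (λ j i → f i j)))))
    where
    sumF²≡sum² : ∀ m n (f : Fin m → Fin n → Carrier) →
                 sumF m (λ i → sumF n (f i)) ≡ sum (λ i → sum (f i))
    sumF²≡sum² m n f = ≡.trans (sumF≡sum m _) (sum-cong-≗ (λ i → sumF≡sum n (f i)))

  sumF-zero : ∀ n {f : Fin n → Carrier} → (∀ i → f i ≈ 0#) → sumF n f ≈ 0#
  sumF-zero n f≈0 = trans (sumF-cong n f≈0)
    (trans (reflexive (sumF≡sum n _)) (sum-replicate-zero n))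

  prodF-cong : ∀ n {f g : Fin n → Carrier} → (∀ i → f i ≈ g i) → prodF n f ≈ prodF n g
  prodF-cong zero    f≈g = refl
  prodF-cong (suc n) f≈g = *-cong (f≈g zero) (prodF-cong n (f≈g ∘ suc))

  x-y-inverse : ∀ {x y} → ¬ x ≈ y → (x - y) * (x - y) ⁻¹ ≈ 1#
  x-y-inverse {x} {y} x≉y = ⁻¹-inverse (x - y) λ x-y≈0 → x≉y (begin
    x              ≈⟨ solve 2 (λ x y → x := (x :- y) :+ y) refl x y ⟩
    (x - y) + y    ≈⟨ +-congʳ x-y≈0 ⟩
    0# + y         ≈⟨ +-identityˡ y ⟩
    y              ∎)

  [y-x]⁻¹≈-[x-y]⁻¹ : ∀ {x y} → ¬ x ≈ y → (y - x) ⁻¹ ≈ - (x - y) ⁻¹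
  [y-x]⁻¹≈-[x-y]⁻¹ {x} {y} x≉y = begin
    B                        ≈⟨ *-identityʳ B ⟨
    B * 1#                   ≈⟨ *-congˡ (x-y-inverse x≉y) ⟨
    B * ((x - y) * A)        ≈⟨ solve 4 (λ x y A B → B :* ((x :- y) :* A) := :- (((y :- x) :* B) :* A))
                                  refl x y A B ⟩
    - (((y - x) * B) * A)    ≈⟨ -‿cong (*-congʳ (x-y-inverse (x≉y ∘ sym))) ⟩
    - (1# * A)               ≈⟨ -‿cong (*-identityˡ A) ⟩
    - A                      ∎
    where
    A B : Carrier
    A = (x - y) ⁻¹
    B = (y - x) ⁻¹

  ⊛-congˡ : ∀ {f f′} g → (∀ k → f k ≈ f′ k) → ∀ N → (f ⊛ g) N ≈ (f′ ⊛ g) N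
  ⊛-congˡ g f≈f′ N = sumF-cong (suc N) (λ i → *-congʳ {g (N ∸ toℕ i)} (f≈f′ (toℕ i)))

  ⊛-congʳ : ∀ f {g g′} → (∀ k → g k ≈ g′ k) → ∀ N → (f ⊛ g) N ≈ (f ⊛ g′) N
  ⊛-congʳ f g≈g′ N = sumF-cong (suc N) (λ i → *-congˡ {f (toℕ i)} (g≈g′ (N ∸ toℕ i)))

  ⊛-zeroˡ : ∀ g N → ((λ _ → 0#) ⊛ g) N ≈ 0#
  ⊛-zeroˡ g N = sumF-zero (suc N) {λ i → 0# * g (N ∸ toℕ i)} (λ i → zeroˡ _)

  ⊛-identityˡ : ∀ g N → (oneS ⊛ g) N ≈ g N
  ⊛-identityˡ g N = trans (+-cong (*-identityˡ (g N)) higher≈0) (+-identityʳ (g N))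
    where
    higher≈0 : sumF N (λ i → 0# * g (N ∸ suc (toℕ i))) ≈ 0#
    higher≈0 = sumF-zero N (λ i → zeroˡ _)

  ⊛-identityʳ : ∀ f N → (f ⊛ oneS) N ≈ f N
  ⊛-identityʳ f zero    = trans (+-identityʳ _) (*-identityʳ _)
  ⊛-identityʳ f (suc N) = trans (+-cong (zeroʳ _) (⊛-identityʳ (f ∘ suc) N)) (+-identityˡ _)

  ⊛-distribʳ : ∀ f f′ g N → ((λ k → f k + f′ k) ⊛ g) N ≈ (f ⊛ g) N + (f′ ⊛ g) N
  ⊛-distribʳ f f′ g N = trans (sumF-cong (suc N) (λ i → distribʳ (g′ i) (f (toℕ i)) (f′ (toℕ i))))
                              (sumF-+ (suc N) (λ i → f (toℕ i) * g′ i) (λ i → f′ (toℕ i) * g′ i))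
    where
    g′ : Fin (suc N) → Carrier
    g′ i = g (N ∸ toℕ i)

  ⊛-scaleˡ : ∀ a f g N → ((λ k → a * f k) ⊛ g) N ≈ a * (f ⊛ g) N
  ⊛-scaleˡ a f g N = trans (sumF-cong (suc N) (λ i → *-assoc a (f (toℕ i)) (g′ i)))
                           (sym (*-distribˡ-sumF (suc N) a (λ i → f (toℕ i) * g′ i)))
    where
    g′ : Fin (suc N) → Carrier
    g′ i = g (N ∸ toℕ i)

  ⊛-scaleʳ : ∀ a f g N → (f ⊛ (λ k → a * g k)) N ≈ a * (f ⊛ g) N
  ⊛-scaleʳ a f g N = trans (sumF-cong (suc N) (λ i → x∙yz≈y∙xz (f (toℕ i)) a (g′ i)))
                           (sym (*-distribˡ-sumF (suc N) a (λ i → f (toℕ i) * g′ i)))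
    where
    g′ : Fin (suc N) → Carrier
    g′ i = g (N ∸ toℕ i)

  ⊛-combinationʳ : ∀ f g m (c : Fin m → Carrier) (h : Fin m → Series) N →
    (f ⊛ (λ k → g k + sumF m (λ i → c i * h i k))) N
      ≈ (f ⊛ g) N + sumF m (λ i → c i * (f ⊛ h i) N)
  ⊛-combinationʳ f g m c h N = begin
    sumF (suc N) (λ r → f′ r * (g′ r + sumF m (λ i → c i * h′ i r)))
      ≈⟨ sumF-cong (suc N) (λ r → trans (distribˡ (f′ r) (g′ r) _)
                                     (+-congˡ (*-distribˡ-sumF m (f′ r) (λ i → c i * h′ i r)))) ⟩
    sumF (suc N) (λ r → f′ r * g′ r + sumF m (λ i → f′ r * (c i * h′ i r)))
      ≈⟨ sumF-+ (suc N) (λ r → f′ r * g′ r) (λ r → sumF m (λ i → f′ r * (c i * h′ i r))) ⟩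
    (f ⊛ g) N + sumF (suc N) (λ r → sumF m (λ i → f′ r * (c i * h′ i r)))
      ≈⟨ +-congˡ (sumF-comm (suc N) m (λ r i → f′ r * (c i * h′ i r))) ⟩
    (f ⊛ g) N + sumF m (λ i → sumF (suc N) (λ r → f′ r * (c i * h′ i r)))
      ≈⟨ +-congˡ (sumF-cong m (λ i → ⊛-scaleʳ (c i) f (h i) N)) ⟩
    (f ⊛ g) N + sumF m (λ i → c i * (f ⊛ h i) N) ∎
    where
    f′ g′ : Fin (suc N) → Carrier
    f′ r = f (toℕ r)
    g′ r = g (N ∸ toℕ r)
    h′ : Fin m → Fin (suc N) → Carrier
    h′ i r = h i (N ∸ toℕ r)

  invLin-suc : ∀ b N → invLin b (suc N) ≈ oneS N + b * invLin b N
  invLin-suc b zero    = sym (trans (+-congˡ (zeroʳ b)) (+-identityʳ 1#))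
  invLin-suc b (suc N) = sym (+-identityˡ _)

  invLin-⊛-zero : ∀ b g → (invLin b ⊛ g) 0 ≈ 0#
  invLin-⊛-zero b g = trans (+-identityʳ _) (zeroˡ (g 0))

  invLin-⊛-suc : ∀ b g N → (invLin b ⊛ g) (suc N) ≈ g N + b * (invLin b ⊛ g) N
  invLin-⊛-suc b g N = begin
    0# * g (suc N) + ((invLin b ∘ suc) ⊛ g) N
      ≈⟨ +-cong (zeroˡ (g (suc N))) (⊛-congˡ g (invLin-suc b) N) ⟩
    0# + ((λ k → oneS k + b * invLin b k) ⊛ g) N
      ≈⟨ +-identityˡ _ ⟩
    ((λ k → oneS k + b * invLin b k) ⊛ g) N
      ≈⟨ ⊛-distribʳ oneS (λ k → b * invLin b k) g N ⟩
    (oneS ⊛ g) N + ((λ k → b * invLin b k) ⊛ g) N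
      ≈⟨ +-cong (⊛-identityˡ g N) (⊛-scaleˡ b (invLin b) g N) ⟩
    g N + b * (invLin b ⊛ g) N ∎

  invLin-⊛-cong< : ∀ b {g g′} N → (∀ k → k < N → g k ≈ g′ k) →
                   (invLin b ⊛ g) N ≈ (invLin b ⊛ g′) N
  invLin-⊛-cong< b {g} {g′} zero    g≈g′ = trans (invLin-⊛-zero b g) (sym (invLin-⊛-zero b g′))
  invLin-⊛-cong< b {g} {g′} (suc N) g≈g′ = begin
    (invLin b ⊛ g) (suc N)        ≈⟨ invLin-⊛-suc b g N ⟩
    g N + b * (invLin b ⊛ g) N    ≈⟨ +-cong (g≈g′ N ℕ.≤-refl)
                                            (*-congˡ (invLin-⊛-cong< b N g≈g′↾N)) ⟩
    g′ N + b * (invLin b ⊛ g′) N  ≈⟨ invLin-⊛-suc b g′ N ⟨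
    (invLin b ⊛ g′) (suc N)       ∎
    where
    g≈g′↾N : ∀ k → k < N → g k ≈ g′ k
    g≈g′↾N k k<N = g≈g′ k (ℕ.m<n⇒m<1+n k<N)

  invLin-⊛-invLin : ∀ v y N → (v - y) * (invLin v ⊛ invLin y) N ≈ invLin v N - invLin y N
  invLin-⊛-invLin v y zero =
    solve 2 (λ v y → (v :- y) :* (lit 0 :* lit 0 :+ lit 0) := lit 0 :- lit 0) refl v y
  invLin-⊛-invLin v y (suc N) = begin
    (v - y) * (invLin v ⊛ invLin y) (suc N)
      ≈⟨ *-congˡ (invLin-⊛-suc v (invLin y) N) ⟩
    (v - y) * (Iy + v * H)
      ≈⟨ solve 4 (λ v y Iy H → (v :- y) :* (Iy :+ v :* H) := (v :- y) :* Iy :+ v :* ((v :- y) :* H))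
                 refl v y Iy H ⟩
    (v - y) * Iy + v * ((v - y) * H)
      ≈⟨ +-congˡ (*-congˡ (invLin-⊛-invLin v y N)) ⟩
    (v - y) * Iy + v * (Iv - Iy)
      ≈⟨ solve 5 (λ v y Iv Iy o → (v :- y) :* Iy :+ v :* (Iv :- Iy) := (o :+ v :* Iv) :- (o :+ y :* Iy))
                 refl v y Iv Iy (oneS N) ⟩
    (oneS N + v * Iv) - (oneS N + y * Iy)
      ≈⟨ +-cong (invLin-suc v N) (-‿cong (invLin-suc y N)) ⟨
    invLin v (suc N) - invLin y (suc N) ∎
    where
    Iv Iy H : Carrier
    Iv = invLin v N
    Iy = invLin y N
    H  = (invLin v ⊛ invLin y) N

  fpow-suc : ∀ x b r → fpow x b (suc r) ≈ (x - b 1) * fpow x (τ b) r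
  fpow-suc x b zero    = *-comm 1# (x - b 1)
  fpow-suc x b (suc r) = trans (*-congʳ (fpow-suc x b r)) (*-assoc (x - b 1) _ _)

  newtonSum : Carrier → (ℕ → Carrier) → ℕ → Series
  newtonSum x b K N = sumF K (λ r → fpow x b (toℕ r) * invFpow b (suc (toℕ r)) N)

  newtonSum-suc : ∀ x b K N →
    newtonSum x b (suc K) N ≈ (invLin (b 1) ⊛ (λ k → oneS k + (x - b 1) * newtonSum x (τ b) K k)) N
  newtonSum-suc x b K N = begin
    1# * (invLin (b 1) ⊛ oneS) N + sumF K (λ r → fpow x b (suc (toℕ r)) * (invLin (b 1) ⊛ h r) N)
      ≈⟨ +-cong (*-identityˡ _) (sumF-cong K (λ r → *-congʳ (fpow-suc x b (toℕ r)))) ⟩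
    (invLin (b 1) ⊛ oneS) N + sumF K (λ r → d r * (invLin (b 1) ⊛ h r) N)
      ≈⟨ ⊛-combinationʳ (invLin (b 1)) oneS K d h N ⟨
    (invLin (b 1) ⊛ (λ k → oneS k + sumF K (λ r → d r * h r k))) N
      ≈⟨ ⊛-congʳ (invLin (b 1)) (λ k → +-congˡ {oneS k} (pull-factor k)) N ⟩
    (invLin (b 1) ⊛ (λ k → oneS k + (x - b 1) * newtonSum x (τ b) K k)) N ∎
    where
    d : Fin K → Carrier
    d r = (x - b 1) * fpow x (τ b) (toℕ r)
    h : Fin K → Series
    h r = invFpow (τ b) (suc (toℕ r))
    pull-factor : ∀ k → sumF K (λ r → d r * h r k) ≈ (x - b 1) * newtonSum x (τ b) K k
    pull-factor k = trans (sumF-cong K (λ r → *-assoc (x - b 1) _ _))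
                          (sym (*-distribˡ-sumF K (x - b 1) _))

  invLin-⊛-[1+[x-b]invLin] : ∀ x b N →
    (invLin b ⊛ (λ k → oneS k + (x - b) * invLin x k)) N ≈ invLin x N
  invLin-⊛-[1+[x-b]invLin] x b zero    = invLin-⊛-zero b (λ k → oneS k + (x - b) * invLin x k)
  invLin-⊛-[1+[x-b]invLin] x b (suc N) = begin
    (invLin b ⊛ g) (suc N)
      ≈⟨ invLin-⊛-suc b g N ⟩
    (oneS N + (x - b) * Ix) + b * (invLin b ⊛ g) N
      ≈⟨ +-congˡ (*-congˡ (invLin-⊛-[1+[x-b]invLin] x b N)) ⟩
    (oneS N + (x - b) * Ix) + b * Ix
      ≈⟨ solve 4 (λ o x b I → (o :+ (x :- b) :* I) :+ b :* I := o :+ x :* I) refl (oneS N) x b Ix ⟩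
    oneS N + x * Ix
      ≈⟨ invLin-suc x N ⟨
    invLin x (suc N) ∎
    where
    g : Series
    g k = oneS k + (x - b) * invLin x k
    Ix : Carrier
    Ix = invLin x N

  newtonSum≈invLin : ∀ x K b N → N ≤ K → newtonSum x b K N ≈ invLin x N
  newtonSum≈invLin x zero    b zero z≤n = refl
  newtonSum≈invLin x (suc K) b N  N≤1+K = begin
    newtonSum x b (suc K) N
      ≈⟨ newtonSum-suc x b K N ⟩
    (invLin (b 1) ⊛ (λ k → oneS k + (x - b 1) * newtonSum x (τ b) K k)) N
      ≈⟨ invLin-⊛-cong< (b 1) N (λ k k<N → +-congˡ {oneS k} (*-congˡ
           (newtonSum≈invLin x K (τ b) k (ℕ.≤-pred (ℕ.≤-trans k<N N≤1+K))))) ⟩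
    (invLin (b 1) ⊛ (λ k → oneS k + (x - b 1) * invLin x k)) N
      ≈⟨ invLin-⊛-[1+[x-b]invLin] x (b 1) N ⟩
    invLin x N ∎

  poleS : Carrier → Series
  poleS v N = two * v * invLin v N

  poleAt : Carrier → Carrier → Carrier
  poleAt w v = (two * v) / (w - v)

  ratioAt : Carrier → Carrier → Carrier
  ratioAt w v = (w + v) / (w - v)

  ratio≈oneS+poleS : ∀ v N → ratio v N ≈ oneS N + poleS v N
  ratio≈oneS+poleS v zero    =
    solve 1 (λ v → lit 1 :* lit 1 :+ (v :* lit 0 :+ lit 0) := lit 1 :+ lit 2 :* v :* lit 0) refl v
  ratio≈oneS+poleS v (suc N) = begin
    1# * (v * I) + (v * I + ((λ _ → 0#) ⊛ invLin v) N)
      ≈⟨ +-congˡ (+-congˡ (⊛-zeroˡ (invLin v) N)) ⟩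
    1# * (v * I) + (v * I + 0#)
      ≈⟨ solve 2 (λ v I → lit 1 :* (v :* I) :+ (v :* I :+ lit 0) := lit 0 :+ lit 2 :* v :* I) refl v I ⟩
    0# + two * v * I ∎
    where
    I : Carrier
    I = invLin v (suc N)

  -- Iv, Iy and P stand for 1/(u - v), 1/(u - y) and their product, which satisfies
  -- (v - y) P = Iv - Iy.
  ratio·pole-split : ∀ {v y} Iv Iy P → ¬ v ≈ y → (v - y) * P ≈ Iv - Iy →
    two * y * Iy + two * v * (two * y * P) ≈ poleAt v y * (two * v * Iv) + ratioAt y v * (two * y * Iy)
  ratio·pole-split {v} {y} Iv Iy P v≉y [v-y]P≈Iv-Iy = begin
    two * y * Iy + two * v * (two * y * P)
      ≈⟨ +-congˡ (*-congˡ (*-congˡ P≈A[Iv-Iy])) ⟩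
    two * y * Iy + two * v * (two * y * (A * (Iv - Iy)))
      ≈⟨ solve 5 (λ v y Iv Iy A →
           lit 2 :* y :* Iy :+ lit 2 :* v :* (lit 2 :* y :* (A :* (Iv :- Iy)))
             := (lit 2 :* y :* A :* (lit 2 :* v :* Iv) :+ (y :+ v) :* (:- A) :* (lit 2 :* y :* Iy))
                :+ lit 2 :* y :* Iy :* (lit 1 :- (v :- y) :* A))
           refl v y Iv Iy A ⟩
    (poleAt v y * (two * v * Iv) + (y + v) * (- A) * (two * y * Iy)) + two * y * Iy * (1# - (v - y) * A)
      ≈⟨ +-cong (+-congˡ (*-congʳ (*-congˡ (sym ([y-x]⁻¹≈-[x-y]⁻¹ v≉y))))) vanishing ⟩
    (poleAt v y * (two * v * Iv) + ratioAt y v * (two * y * Iy)) + 0#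
      ≈⟨ +-identityʳ _ ⟩
    poleAt v y * (two * v * Iv) + ratioAt y v * (two * y * Iy) ∎
    where
    A : Carrier
    A = (v - y) ⁻¹
    P≈A[Iv-Iy] : P ≈ A * (Iv - Iy)
    P≈A[Iv-Iy] = begin
      P                    ≈⟨ *-identityˡ P ⟨
      1# * P               ≈⟨ *-congʳ (x-y-inverse v≉y) ⟨
      (v - y) * A * P      ≈⟨ solve 4 (λ v y A P → (v :- y) :* A :* P := A :* ((v :- y) :* P))
                                  refl v y A P ⟩
      A * ((v - y) * P)    ≈⟨ *-congˡ [v-y]P≈Iv-Iy ⟩
      A * (Iv - Iy)        ∎
    vanishing : two * y * Iy * (1# - (v - y) * A) ≈ 0#
    vanishing = trans (*-congˡ (trans (+-congˡ (-‿cong (x-y-inverse v≉y))) (-‿inverseʳ 1#))) (zeroʳ _)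

  ratioAt≈1+poleAt : ∀ {w v} → ¬ w ≈ v → ratioAt w v ≈ 1# + poleAt w v
  ratioAt≈1+poleAt {w} {v} w≉v = begin
    (w + v) * A                  ≈⟨ solve 3 (λ w v A → (w :+ v) :* A := (w :- v) :* A :+ lit 2 :* v :* A)
                                      refl w v A ⟩
    (w - v) * A + two * v * A    ≈⟨ +-congʳ (x-y-inverse w≉v) ⟩
    1# + two * v * A             ∎
    where
    A : Carrier
    A = (w - v) ⁻¹

  ratioAt·poleAt-split : ∀ {w v y} → ¬ w ≈ v → ¬ w ≈ y → ¬ v ≈ y →
    ratioAt w v * poleAt w y ≈ poleAt v y * poleAt w v + ratioAt y v * poleAt w y
  ratioAt·poleAt-split {w} {v} {y} w≉v w≉y v≉y = begin
    ratioAt w v * poleAt w y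
      ≈⟨ *-congʳ (ratioAt≈1+poleAt w≉v) ⟩
    (1# + two * v * Iv) * (two * y * Iy)
      ≈⟨ solve 4 (λ v y Iv Iy → (lit 1 :+ lit 2 :* v :* Iv) :* (lit 2 :* y :* Iy)
                                := lit 2 :* y :* Iy :+ lit 2 :* v :* (lit 2 :* y :* (Iv :* Iy))) refl v y Iv Iy ⟩
    two * y * Iy + two * v * (two * y * (Iv * Iy))
      ≈⟨ ratio·pole-split Iv Iy (Iv * Iy) v≉y [v-y]IvIy≈Iv-Iy ⟩
    poleAt v y * poleAt w v + ratioAt y v * poleAt w y ∎
    where
    Iv Iy : Carrier
    Iv = (w - v) ⁻¹
    Iy = (w - y) ⁻¹
    [v-y]IvIy≈Iv-Iy : (v - y) * (Iv * Iy) ≈ Iv - Iy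
    [v-y]IvIy≈Iv-Iy = begin
      (v - y) * (Iv * Iy)
        ≈⟨ solve 5 (λ w v y Iv Iy → (v :- y) :* (Iv :* Iy) := (w :- y) :* Iy :* Iv :- (w :- v) :* Iv :* Iy)
             refl w v y Iv Iy ⟩
      (w - y) * Iy * Iv - (w - v) * Iv * Iy
        ≈⟨ +-cong (*-congʳ (x-y-inverse w≉y)) (-‿cong (*-congʳ (x-y-inverse w≉v))) ⟩
      1# * Iv - 1# * Iy
        ≈⟨ +-cong (*-identityˡ Iv) (-‿cong (*-identityˡ Iy)) ⟩
      Iv - Iy ∎

  ratio⊛poleS-split : ∀ {v y} → ¬ v ≈ y → ∀ N →
    (ratio v ⊛ poleS y) N ≈ poleAt v y * poleS v N + ratioAt y v * poleS y N
  ratio⊛poleS-split {v} {y} v≉y N = begin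
    (ratio v ⊛ poleS y) N
      ≈⟨ ⊛-congˡ (poleS y) (ratio≈oneS+poleS v) N ⟩
    ((λ k → oneS k + poleS v k) ⊛ poleS y) N
      ≈⟨ ⊛-distribʳ oneS (poleS v) (poleS y) N ⟩
    (oneS ⊛ poleS y) N + (poleS v ⊛ poleS y) N
      ≈⟨ +-cong (⊛-identityˡ (poleS y) N)
                (trans (⊛-scaleˡ (two * v) (invLin v) (poleS y) N)
                       (*-congˡ (⊛-scaleʳ (two * y) (invLin v) (invLin y) N))) ⟩
    two * y * invLin y N + two * v * (two * y * (invLin v ⊛ invLin y) N)
      ≈⟨ ratio·pole-split (invLin v N) (invLin y N) _ v≉y (invLin-⊛-invLin v y N) ⟩
    poleAt v y * poleS v N + ratioAt y v * poleS y N ∎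

  skipIf : {A : Set} → Dec A → Carrier → Carrier
  skipIf (yes _) _ = 1#
  skipIf (no _)  y = y

  -- The factors of prodNe are local to its definition in Defs; they are reached through
  -- its unfolding.
  prodNe≈prodF-skipIf : ∀ n i f → prodNe n i f ≈ prodF n (λ j → skipIf (i ≟ j) (f j))
  prodNe≈prodF-skipIf n i f = trans (reflexive (proj₂ unfolded)) (prodF-cong n factor)
    where
    unfolded : Σ[ h ∈ (Fin n → Carrier) ] prodNe n i f ≡ prodF n h
    unfolded = _ , ≡.refl
    factor : ∀ j → proj₁ unfolded j ≈ skipIf (i ≟ j) (f j)
    factor j with i ≟ j
    ... | yes _ = refl
    ... | no _  = refl

  prodNe-suc : ∀ n i f → prodNe (suc n) (suc i) f ≈ f zero * prodNe n i (f ∘ suc)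
  prodNe-suc n i f = begin
    prodNe (suc n) (suc i) f
      ≈⟨ prodNe≈prodF-skipIf (suc n) (suc i) f ⟩
    f zero * prodF n (λ j → skipIf (suc i ≟ suc j) (f (suc j)))
      ≈⟨ *-congˡ (prodF-cong n skipIf-suc) ⟩
    f zero * prodF n (λ j → skipIf (i ≟ j) (f (suc j)))
      ≈⟨ *-congˡ (prodNe≈prodF-skipIf n i (f ∘ suc)) ⟨
    f zero * prodNe n i (f ∘ suc) ∎
    where
    skipIf-suc : ∀ j → skipIf (suc i ≟ suc j) (f (suc j)) ≈ skipIf (i ≟ j) (f (suc j))
    skipIf-suc j with i ≟ j
    ... | yes _ = refl
    ... | no _  = refl

  partialCoeff : (n : ℕ) → (Fin n → Carrier) → Fin n → Carrier
  partialCoeff n x i = prodNe n i (λ j → ratioAt (x i) (x j))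

  partialCoeff-suc : ∀ m x i →
    partialCoeff (suc m) x (suc i) ≈ ratioAt (x (suc i)) (x zero) * partialCoeff m (x ∘ suc) i
  partialCoeff-suc m x i = prodNe-suc m i (λ j → ratioAt (x (suc i)) (x j))

  Distinct : (n : ℕ) → (Fin n → Carrier) → Set ℓ
  Distinct n x = ∀ i j → i ≢ j → ¬ x i ≈ x j

  Distinct-tail : ∀ {m x} → Distinct (suc m) x → Distinct m (x ∘ suc)
  Distinct-tail distinct i j i≢j = distinct (suc i) (suc j) (i≢j ∘ suc-injective)

  -- A space of functions I → F standing for rational functions of u: `one` is 1, `pole v`
  -- is 2v/(u - v) and `ratioMul v` is multiplication by (u + v)/(u - v).
  record PoleAlgebra (I : Set) : Set (c ⊔ lsuc ℓ) where
    field
      one        : I → Carrier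
      pole       : Carrier → I → Carrier
      ratioMul   : Carrier → (I → Carrier) → I → Carrier
      Admissible : Carrier → Set ℓ
      ratioMul-cong   : ∀ v {f g} → (∀ k → f k ≈ g k) → ∀ k → ratioMul v f k ≈ ratioMul v g k
      ratioMul-linear : ∀ v f m (d : Fin m → Carrier) (g : Fin m → I → Carrier) k →
        ratioMul v (λ k → f k + sumF m (λ i → d i * g i k)) k
          ≈ ratioMul v f k + sumF m (λ i → d i * ratioMul v (g i) k)
      ratioMul-one    : ∀ {v} → Admissible v → ∀ k → ratioMul v one k ≈ one k + pole v k
      ratioMul-pole   : ∀ {v y} → Admissible v → Admissible y → ¬ v ≈ y → ∀ k →
        ratioMul v (pole y) k ≈ poleAt v y * pole v k + ratioAt y v * pole y k

    ratioProd : (n : ℕ) → (Fin n → Carrier) → I → Carrier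
    ratioProd zero    x = one
    ratioProd (suc n) x = ratioMul (x zero) (ratioProd n (x ∘ suc))

  open PoleAlgebra public

  evaluationAt : Carrier → PoleAlgebra ⊤
  evaluationAt w = record
    { one             = λ _ → 1#
    ; pole            = λ v _ → poleAt w v
    ; ratioMul        = λ v f t → ratioAt w v * f t
    ; Admissible      = λ v → ¬ w ≈ v
    ; ratioMul-cong   = λ v f≈g t → *-congˡ (f≈g t)
    ; ratioMul-linear = λ v f m d g t → linear (ratioAt w v) (f t) m d (λ i → g i t)
    ; ratioMul-one    = λ w≉v t → trans (*-identityʳ _) (ratioAt≈1+poleAt w≉v)
    ; ratioMul-pole   = λ w≉v w≉y v≉y t → ratioAt·poleAt-split w≉v w≉y v≉y
    }
    where
    linear : ∀ r e m (d g : Fin m → Carrier) →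
             r * (e + sumF m (λ i → d i * g i)) ≈ r * e + sumF m (λ i → d i * (r * g i))
    linear r e m d g = trans (distribˡ r e _)
      (+-congˡ (trans (*-distribˡ-sumF m r _) (sumF-cong m (λ i → x∙yz≈y∙xz r (d i) (g i)))))

  ratioProd-evaluationAt : ∀ w n x → ratioProd (evaluationAt w) n x tt ≡ prodF n (λ j → ratioAt w (x j))
  ratioProd-evaluationAt w zero    x = ≡.refl
  ratioProd-evaluationAt w (suc n) x = ≡.cong (ratioAt w (x zero) *_) (ratioProd-evaluationAt w n (x ∘ suc))

  expansion : PoleAlgebra ℕ
  expansion = record
    { one             = oneS
    ; pole            = poleS
    ; ratioMul        = λ v f → ratio v ⊛ f
    ; Admissible      = λ _ → ⊤
    ; ratioMul-cong   = λ v → ⊛-congʳ (ratio v)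
    ; ratioMul-linear = λ v → ⊛-combinationʳ (ratio v)
    ; ratioMul-one    = λ {v} _ N → trans (⊛-identityʳ (ratio v) N) (ratio≈oneS+poleS v N)
    ; ratioMul-pole   = λ _ _ → ratio⊛poleS-split
    }

  ratioProd-expansion : ∀ n x N → ratioProd expansion n x N ≈ prodS n (λ j → ratio (x j)) N
  ratioProd-expansion zero    x N = refl
  ratioProd-expansion (suc n) x N = ⊛-congʳ (ratio (x zero)) (ratioProd-expansion n (x ∘ suc)) N

  regroup-by-q : ∀ m (d p r g : Fin m → Carrier) o q →
    (o + q) + sumF m (λ i → d i * (p i * q + r i * g i))
      ≈ o + ((1# + sumF m (λ i → d i * p i)) * q + sumF m (λ i → (r i * d i) * g i))
  regroup-by-q m d p r g o q = begin
    (o + q) + sumF m (λ i → d i * (p i * q + r i * g i))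
      ≈⟨ +-congˡ (sumF-cong m (λ i →
           solve 5 (λ d p q r g → d :* (p :* q :+ r :* g) := d :* p :* q :+ r :* d :* g)
             refl (d i) (p i) q (r i) (g i))) ⟩
    (o + q) + sumF m (λ i → d i * p i * q + r i * d i * g i)
      ≈⟨ +-congˡ (sumF-+ m (λ i → d i * p i * q) (λ i → r i * d i * g i)) ⟩
    (o + q) + (sumF m (λ i → d i * p i * q) + S₂)
      ≈⟨ +-congˡ (+-congʳ (*-distribʳ-sumF m q (λ i → d i * p i))) ⟨
    (o + q) + (S₁ * q + S₂)
      ≈⟨ solve 4 (λ o q S₁ S₂ → (o :+ q) :+ (S₁ :* q :+ S₂) := o :+ ((lit 1 :+ S₁) :* q :+ S₂))
           refl o q S₁ S₂ ⟩
    o + ((1# + S₁) * q + S₂) ∎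
    where
    S₁ S₂ : Carrier
    S₁ = sumF m (λ i → d i * p i)
    S₂ = sumF m (λ i → (r i * d i) * g i)

  ratioProd-partialFractions : ∀ {I} (𝒜 : PoleAlgebra I) n x →
    (∀ i → Admissible 𝒜 (x i)) → Distinct n x →
    ∀ k → ratioProd 𝒜 n x k ≈ one 𝒜 k + sumF n (λ i → partialCoeff n x i * pole 𝒜 (x i) k)
  ratioProd-partialFractions 𝒜 zero    x _ _ k = sym (+-identityʳ _)
  ratioProd-partialFractions 𝒜 (suc m) x admissible distinct k = begin
    ratioMul 𝒜 w (ratioProd 𝒜 m z) k
      ≈⟨ ratioMul-cong 𝒜 w (ratioProd-partialFractions 𝒜 m z (admissible ∘ suc) distinct-z) k ⟩
    ratioMul 𝒜 w (λ k → one 𝒜 k + sumF m (λ i → d i * pole 𝒜 (z i) k)) k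
      ≈⟨ ratioMul-linear 𝒜 w (one 𝒜) m d (pole 𝒜 ∘ z) k ⟩
    ratioMul 𝒜 w (one 𝒜) k + sumF m (λ i → d i * ratioMul 𝒜 w (pole 𝒜 (z i)) k)
      ≈⟨ +-cong (ratioMul-one 𝒜 (admissible zero) k) (sumF-cong m (λ i → *-congˡ
           (ratioMul-pole 𝒜 (admissible zero) (admissible (suc i)) (w≉z i) k))) ⟩
    (one 𝒜 k + pole 𝒜 w k)
      + sumF m (λ i → d i * (poleAt w (z i) * pole 𝒜 w k + ratioAt (z i) w * pole 𝒜 (z i) k))
      ≈⟨ regroup-by-q m d (poleAt w ∘ z) (λ i → ratioAt (z i) w) (λ i → pole 𝒜 (z i) k)
                      (one 𝒜 k) (pole 𝒜 w k) ⟩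
    one 𝒜 k + ((1# + sumF m (λ i → d i * poleAt w (z i))) * pole 𝒜 w k
               + sumF m (λ i → (ratioAt (z i) w * d i) * pole 𝒜 (z i) k))
      ≈⟨ +-congˡ (+-cong (*-congʳ (sym partialCoeff-zero))
                         (sumF-cong m (λ i → *-congʳ (sym (partialCoeff-suc m x i))))) ⟩
    one 𝒜 k + sumF (suc m) (λ i → partialCoeff (suc m) x i * pole 𝒜 (x i) k) ∎
    where
    w : Carrier
    w = x zero
    z : Fin m → Carrier
    z = x ∘ suc
    d : Fin m → Carrier
    d = partialCoeff m z
    distinct-z : Distinct m z
    distinct-z = Distinct-tail distinct
    w≉z : ∀ i → ¬ w ≈ z i
    w≉z i = distinct zero (suc i) (λ ())
    partialCoeff-zero : partialCoeff (suc m) x zero ≈ 1# + sumF m (λ i → d i * poleAt w (z i))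
    partialCoeff-zero = begin
      1# * prodF m (λ j → ratioAt w (z j))  ≈⟨ *-identityˡ _ ⟩
      prodF m (λ j → ratioAt w (z j))       ≡⟨ ratioProd-evaluationAt w m z ⟨
      ratioProd (evaluationAt w) m z tt
        ≈⟨ ratioProd-partialFractions (evaluationAt w) m z w≉z distinct-z tt ⟩
      1# + sumF m (λ i → d i * poleAt w (z i)) ∎

  fpow-suc-a₁≈0 : ∀ {a} → a 1 ≈ 0# → ∀ u r → fpow u a (suc r) ≈ u * fpow u (τ a) r
  fpow-suc-a₁≈0 {a} a₁≈0 u r = trans (fpow-suc u a r) (*-congʳ u-a₁≈u)
    where
    u-a₁≈u : u - a 1 ≈ u
    u-a₁≈u = trans (+-congˡ (-‿cong a₁≈0)) (solve 1 (λ u → u :- lit 0 := u) refl u)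

  sumP·invFpow≈sum-newtonSum : ∀ {a} → a 1 ≈ 0# → ∀ n x K N →
    sumF K (λ r → P a (suc (toℕ r)) n x * invFpow (τ a) (suc (toℕ r)) N)
      ≈ sumF n (λ i → partialCoeff n x i * (x i * newtonSum (x i) (τ a) K N))
  sumP·invFpow≈sum-newtonSum {a} a₁≈0 n x K N = begin
    sumF K (λ r → sumF n (λ i → fpow (x i) a (suc (toℕ r)) * e i) * T r)
      ≈⟨ sumF-cong K (λ r → trans (*-distribʳ-sumF n (T r) (λ i → fpow (x i) a (suc (toℕ r)) * e i))
                                   (sumF-cong n (λ i → rearrange i r))) ⟩
    sumF K (λ r → sumF n (λ i → e i * (x i * (fpow (x i) (τ a) (toℕ r) * T r))))
      ≈⟨ sumF-comm K n (λ r i → e i * (x i * (fpow (x i) (τ a) (toℕ r) * T r))) ⟩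
    sumF n (λ i → sumF K (λ r → e i * (x i * (fpow (x i) (τ a) (toℕ r) * T r))))
      ≈⟨ sumF-cong n (λ i → sym (trans (*-congˡ (*-distribˡ-sumF K (x i) _))
                                        (*-distribˡ-sumF K (e i) _))) ⟩
    sumF n (λ i → e i * (x i * newtonSum (x i) (τ a) K N)) ∎
    where
    e : Fin n → Carrier
    e = partialCoeff n x
    T : Fin K → Carrier
    T r = invFpow (τ a) (suc (toℕ r)) N
    rearrange : ∀ i r →
      fpow (x i) a (suc (toℕ r)) * e i * T r ≈ e i * (x i * (fpow (x i) (τ a) (toℕ r) * T r))
    rearrange i r = trans (*-congʳ (*-congʳ (fpow-suc-a₁≈0 a₁≈0 (x i) (toℕ r))))
      (solve 4 (λ u f e t → u :* f :* e :* t := e :* (u :* (f :* t)))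
         refl (x i) (fpow (x i) (τ a) (toℕ r)) (e i) (T r))

  lhsCoeff≈oneS+partialFractions : ∀ {a} → a 1 ≈ 0# → ∀ n x N →
    lhsCoeff a n x N ≈ oneS N + sumF n (λ i → partialCoeff n x i * poleS (x i) N)
  lhsCoeff≈oneS+partialFractions {a} a₁≈0 n x N = begin
    1# * oneS N + sumF N (λ r → two * P a (suc (toℕ r)) n x * T r)
      ≈⟨ +-cong (*-identityˡ _)
                (trans (sumF-cong N (λ r → *-assoc two _ _)) (sym (*-distribˡ-sumF N two _))) ⟩
    oneS N + two * sumF N (λ r → P a (suc (toℕ r)) n x * T r)
      ≈⟨ +-congˡ (*-congˡ (sumP·invFpow≈sum-newtonSum a₁≈0 n x N N)) ⟩
    oneS N + two * sumF n (λ i → e i * (x i * newtonSum (x i) (τ a) N N))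
      ≈⟨ +-congˡ (*-congˡ (sumF-cong n (λ i →
           *-congˡ (*-congˡ (newtonSum≈invLin (x i) N (τ a) N ℕ.≤-refl))))) ⟩
    oneS N + two * sumF n (λ i → e i * (x i * invLin (x i) N))
      ≈⟨ +-congˡ (trans (*-distribˡ-sumF n two _) (sumF-cong n (λ i →
           solve 3 (λ e u I → lit 2 :* (e :* (u :* I)) := e :* (lit 2 :* u :* I))
             refl (e i) (x i) (invLin (x i) N)))) ⟩
    oneS N + sumF n (λ i → e i * poleS (x i) N) ∎
    where
    e : Fin n → Carrier
    e = partialCoeff n x
    T : Fin N → Carrier
    T r = invFpow (τ a) (suc (toℕ r)) N

theorem8p2 : {c ℓ : Level} (F : Field c ℓ) →
    let open Field F in let open FieldDefs F in
    (a : ℕ → Carrier) → a 1 ≈ 0# →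
    (n : ℕ) (x : Fin n → Carrier) →
    (∀ i j → i ≢ j → ¬ (x i ≈ x j)) →
    (N : ℕ) → lhsCoeff a n x N ≈ rhsCoeff n x N
theorem8p2 F a a₁≈0 n x distinct N = begin
  lhsCoeff a n x N
    ≈⟨ lhsCoeff≈oneS+partialFractions a₁≈0 n x N ⟩
  oneS N + sumF n (λ i → partialCoeff n x i * poleS (x i) N)
    ≈⟨ ratioProd-partialFractions expansion n x (λ _ → tt) distinct N ⟨
  ratioProd expansion n x N
    ≈⟨ ratioProd-expansion n x N ⟩
  rhsCoeff n x N ∎
  where
  open Field F
  open FieldDefs F
  open Lemmas F
  open import Relation.Binary.Reasoning.Setoid setoid
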